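{- Let $G_1=(V_1,E_1)$ and $G_2=(V_2,E_2)$ be connected graphs. (1) If $V_1\cap V_2=\{u\}$, then $\mathcal{C}(G_1\oplus_u G_2)=\mathcal{C}(G_1)\cup\mathcal{C}(G_2)$. (2) If $V_1\cap V_2=\{u,v\}$ and $E_1\cap E_2=\{uv\}$, then for $e=uv$: $\mathcal{C}(G_1\oplus_e G_2)=\mathcal{C}_{\bar e}(G_1)\cup\mathcal{C}_{\bar e}(G_2)\cup(\mathcal{C}_e(G_1)\uplus\mathcal{C}_e(G_2))$. (3) If $V_1\cap V_2=\{u,v\}$, $E_1\cap E_2=\{uv\}$, $G_1\setminus uv$ is connected and $G_2\setminus uv$ is not connected, then for $e=uv$: $\mathcal{C}(G_1\oplus_e^- G_2)=\mathcal{C}(G_1\setminus e)\cup\mathcal{C}_{\bar e}(G_2)$. (4) If $V_1\cap V_2=\{u,v\}$, $E_1\cap E_2=\{uv\}$, and both $G_1\setminus uv$ and $G_2\setminus uv$ are connected, then for $e=uv$: $\mathcal{C}(G_1\oplus_e^- G_2)=\mathcal{C}_{\bar e}(G_1)\cup\mathcal{C}_{\bar e}(G_2)\cup(\mathcal{C}_{uv}(G_1\setminus e)\uplus\mathcal{C}_{uv}(G_2\setminus e))$.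
   Context: For a graph $G=(V,E)$, a bond is a cut $(S,V\setminus S)$ such that both induced subgraphs $G[S]$ and $G[V\setminus S]$ are connected; a bond is identified with its edge set $\delta(S)$ (the edges with exactly one endpoint in $S$). $\mathcal{C}(G)$ is the set of all bonds of $G$; $\mathcal{C}_{uv}(G)$ is the set of bonds with $u$ and $v$ on different sides; $\mathcal{C}_{\overline{uv}}(G)$ is the set of bonds with $u,v$ on the same side; when $e=uv$ is an edge, $\mathcal{C}_e(G)=\mathcal{C}_{uv}(G)$ and $\mathcal{C}_{\bar e}(G)=\mathcal{C}_{\overline{uv}}(G)$. For families $\mathcal{C}_1,\mathcal{C}_2$ of edge sets, $\mathcal{C}_1\uplus\mathcal{C}_2=\{C_1\cup C_2: C_1\in\mathcal{C}_1, C_2\in\mathcal{C}_2\}$. $G\setminus e$ denotes $G$ with edge $e$ deleted. Sums: if $V_1\cap V_2=\{u\}$, $G_1\oplus_u G_2=(V_1\cup V_2,E_1\cup E_2)$; if $V_1\cap V_2=\{u,v\}$, $E_1\cap E_2=\{e\}$ with $e=uv$, then $G_1\oplus_e G_2=(V_1\cup V_2,E_1\cup E_2)$ and $G_1\oplus_e^- G_2=(V_1\cup V_2,(E_1\cup E_2)\setminus\{e\})$. -}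

module Defs where

open import Data.Nat using (ℕ)
open import Data.Fin using (Fin)
open import Data.Bool using (Bool; _∧_; _xor_)
open import Data.Vec using (lookup; tabulate)
open import Data.Product using (_×_; _,_; proj₁; proj₂; ∃; ∃-syntax)
open import Data.Sum using (_⊎_)
open import Relation.Binary.PropositionalEquality using (_≡_)
open import Function.Bundles using (_⇔_)
open import Data.Fin.Subset public
  using (Subset; _∈_; _∉_; _⊆_; _∩_; _∪_; _─_; _-_; ⁅_⁆; Nonempty)

-- Ambient universe: n vertex labels (Fin n) and m edge labels (Fin m);
-- each edge label has two endpoints given by  ends : Fin m → Fin n × Fin n.
-- (Edges are labelled objects, so graphs sharing an edge share the same label;
-- parallel edges and loops are permitted, i.e. general multigraphs.)

record Graph (n m : ℕ) : Set where
  constructor graph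
  field
    verts : Subset n
    edges : Subset m
open Graph public

module _ {n m : ℕ} (ends : Fin m → Fin n × Fin n) where

  WellFormed : Graph n m → Set
  WellFormed G = ∀ e → e ∈ edges G →
    (proj₁ (ends e) ∈ verts G) × (proj₂ (ends e) ∈ verts G)

  Joins : Fin m → Fin n → Fin n → Set
  Joins e x y = (ends e ≡ (x , y)) ⊎ (ends e ≡ (y , x))

  -- walks in the induced subgraph G[S] (all vertices after the start lie in S)
  data Reach (G : Graph n m) (S : Subset n) : Fin n → Fin n → Set where
    here : ∀ {x} → Reach G S x x
    step : ∀ {x y z} e → e ∈ edges G → Joins e x y → y ∈ S →
           Reach G S y z → Reach G S x z

  ConnectedOn : Graph n m → Subset n → Set
  ConnectedOn G S = Nonempty S × (∀ x y → x ∈ S → y ∈ S → Reach G S x y)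

  Connected : Graph n m → Set
  Connected G = ConnectedOn G (verts G)

  δ : Graph n m → Subset n → Subset m
  δ G S = tabulate λ e →
    lookup (edges G) e ∧ (lookup S (proj₁ (ends e)) xor lookup S (proj₂ (ends e)))

  BondCut : Graph n m → Subset n → Set
  BondCut G S = (S ⊆ verts G) × ConnectedOn G S × ConnectedOn G (verts G ─ S)

  Family : Set₁
  Family = Subset m → Set

  Bonds : Graph n m → Family
  Bonds G C = ∃[ S ] BondCut G S × (C ≡ δ G S)

  BondsSep : Graph n m → Fin n → Fin n → Family
  BondsSep G u v C = ∃[ S ] BondCut G S × (C ≡ δ G S) ×
    ((u ∈ S × v ∈ (verts G ─ S)) ⊎ (v ∈ S × u ∈ (verts G ─ S)))

  BondsSame : Graph n m → Fin n → Fin n → Family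
  BondsSame G u v C = ∃[ S ] BondCut G S × (C ≡ δ G S) ×
    ((u ∈ S × v ∈ S) ⊎ (u ∈ (verts G ─ S) × v ∈ (verts G ─ S)))

  BondsE : Graph n m → Fin m → Family
  BondsE G e = BondsSep G (proj₁ (ends e)) (proj₂ (ends e))

  BondsĒ : Graph n m → Fin m → Family
  BondsĒ G e = BondsSame G (proj₁ (ends e)) (proj₂ (ends e))

infixr 6 _∪ᶠ_
infixr 7 _⊎ᶠ_
infix 4 _≈ᶠ_

_∪ᶠ_ : ∀ {m} → (Subset m → Set) → (Subset m → Set) → (Subset m → Set)
(P ∪ᶠ Q) C = P C ⊎ Q C

_⊎ᶠ_ : ∀ {m} → (Subset m → Set) → (Subset m → Set) → (Subset m → Set)
(P ⊎ᶠ Q) C = ∃[ C₁ ] ∃[ C₂ ] P C₁ × Q C₂ × (C ≡ C₁ ∪ C₂)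

_≈ᶠ_ : ∀ {m} → (Subset m → Set) → (Subset m → Set) → Set
P ≈ᶠ Q = ∀ C → P C ⇔ Q C

_⊕_ : ∀ {n m} → Graph n m → Graph n m → Graph n m
G₁ ⊕ G₂ = graph (verts G₁ ∪ verts G₂) (edges G₁ ∪ edges G₂)

_⊕⁻[_]_ : ∀ {n m} → Graph n m → Fin m → Graph n m → Graph n m
G₁ ⊕⁻[ e ] G₂ = graph (verts G₁ ∪ verts G₂) ((edges G₁ ∪ edges G₂) - e)

_∖ₑ_ : ∀ {n m} → Graph n m → Fin m → Graph n m
G ∖ₑ e = graph (verts G) (edges G - e)

-- A bond δ(S) of a graph H glued from A and B along {u, v} either keeps u and v on one side or
-- separates them. In the first case the side avoiding u and v is connected and misses the
-- separator, so it lies inside one piece, say A; it is then a bond of A completed by an edge uv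
-- whenever B joins u to v, because a walk of H leaves A only through u or v and each excursion
-- into B can be traded for that edge. In the second case S ∩ V(A) and S ∩ V(B) are bonds of A
-- and B separating u from v whose cuts make up δ(S), and conversely two such bonds glue along u
-- and v. The four statements are instances: u = v for the 1-sum, and pieces G₁, G₂ or G₁ ∖ e,
-- G₂ ∖ e for the e-sums. When e is a bridge of G₂, every bond of G₂ ∖ e separating u from v has
-- an empty cut, and the component of u provides one.

module Submission where

open import Defs
open import Data.Nat using (ℕ; zero; suc; _≤_)
open import Data.Nat.Properties using (≤-pred; ≤-refl; <-≤-trans; n≮0)
open import Data.Fin using (Fin; _≟_)
open import Data.Fin.Properties using (any?)
open import Data.Fin.Subset using (∣_∣) renaming (⊥ to ∅)
open import Data.Fin.Subset.Properties
  using (_∈?_; drop-there; ⊆-antisym; ⊥⊆; x∈p∪q⁺; x∈p∪q⁻; x∈p∩q⁺; x∈p∩q⁻; p∩q⊆q; ∪-idem; x∈⁅x⁆; x∈⁅y⁆⇒x≡y;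
         p─q⊆p; x∈p∧x≢y⇒x∈p-y; x∈p⇒∣p-x∣<∣p∣; ∪-identityʳ)
  renaming (x∈p∧x∉q⇒x∈p─q to x∈p─q⁺)
open import Data.Bool using (true; false; _∧_; _xor_)
open import Data.Vec using (_∷_; lookup; tabulate; here; there)
open import Data.Vec.Properties using (lookup∘tabulate; []=⇒lookup; lookup⇒[]=)
open import Data.Product as Product using (_×_; _,_; proj₁; proj₂; ∃-syntax)
open import Data.Product.Properties using (≡-dec)
open import Data.Sum as Sum using (_⊎_; inj₁; inj₂; [_,_]) renaming (swap to ⊎-swap)
open import Data.Empty using (⊥-elim)
open import Function using (_∘_; id; flip)
open import Function.Bundles using (_⇔_; mk⇔; Equivalence)
open import Function.Properties.Equivalence using () renaming (sym to ⇔-sym; trans to ⇔-trans)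
open import Relation.Binary.PropositionalEquality using (_≡_; _≢_; refl; sym; trans; cong; cong₂; subst)
open import Relation.Nullary using (¬_; Dec; yes; no; does)
open import Relation.Nullary.Decidable using (_×-dec_; _⊎-dec_; map′; dec-true)

private
  variable
    k : ℕ

x∈p─q⁻ : ∀ (p q : Subset k) {x} → x ∈ p ─ q → x ∈ p × x ∉ q
x∈p─q⁻ (true ∷ p) (false ∷ q) here       = here , λ ()
x∈p─q⁻ (_ ∷ p)    (true ∷ q)  (there x∈) = Product.map there (λ x∉q → x∉q ∘ drop-there) (x∈p─q⁻ p q x∈)
x∈p─q⁻ (_ ∷ p)    (false ∷ q) (there x∈) = Product.map there (λ x∉q → x∉q ∘ drop-there) (x∈p─q⁻ p q x∈)

lookup≡false⇒∉ : ∀ {p : Subset k} {x} → lookup p x ≡ false → x ∉ p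
lookup≡false⇒∉ p[x]≡false x∈p with trans (sym p[x]≡false) ([]=⇒lookup x∈p)
... | ()

∉⇒lookup≡false : ∀ {p : Subset k} {x} → x ∉ p → lookup p x ≡ false
∉⇒lookup≡false {p = p} {x} x∉p with lookup p x in p[x]
... | true  = ⊥-elim (x∉p (lookup⇒[]= _ _ p[x]))
... | false = refl

x∈p─q⇒x∉q : ∀ {p q : Subset k} {x} → x ∈ p ─ q → x ∉ q
x∈p─q⇒x∉q {p = p} {q} = proj₂ ∘ x∈p─q⁻ p q

x∈q⇒x∉p─q : ∀ {p q : Subset k} {x} → x ∈ q → x ∉ p ─ q
x∈q⇒x∉p─q x∈q x∈p─q = x∈p─q⇒x∉q x∈p─q x∈q

x∈p∧x∉p─q⇒x∈q : ∀ {p q : Subset k} {x} → x ∈ p → x ∉ p ─ q → x ∈ q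
x∈p∧x∉p─q⇒x∈q {q = q} {x} x∈p x∉p─q with x ∈? q
... | yes x∈q = x∈q
... | no  x∉q = ⊥-elim (x∉p─q (x∈p─q⁺ x∈p x∉q))

p─[p─q]≡q : ∀ {p q : Subset k} → q ⊆ p → p ─ (p ─ q) ≡ q
p─[p─q]≡q {p = p} {q} q⊆p = ⊆-antisym
  (λ x∈ → let x∈p , x∉p─q = x∈p─q⁻ p (p ─ q) x∈ in x∈p∧x∉p─q⇒x∈q x∈p x∉p─q)
  (λ x∈q → x∈p─q⁺ (q⊆p x∈q) (x∈q⇒x∉p─q x∈q))

x∈⁅y⁆∪⁅z⁆⇒ : ∀ {x y z : Fin k} → x ∈ ⁅ y ⁆ ∪ ⁅ z ⁆ → x ≡ y ⊎ x ≡ z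
x∈⁅y⁆∪⁅z⁆⇒ {y = y} {z} = Sum.map (x∈⁅y⁆⇒x≡y y) (x∈⁅y⁆⇒x≡y z) ∘ x∈p∪q⁻ ⁅ y ⁆ ⁅ z ⁆

≈ᶠ-trans : ∀ {P Q R : Subset k → Set} → P ≈ᶠ Q → Q ≈ᶠ R → P ≈ᶠ R
≈ᶠ-trans P≈Q Q≈R C = ⇔-trans (P≈Q C) (Q≈R C)

module _ {n m : ℕ} (ends : Fin m → Fin n × Fin n) where

  -- Cuts

  Separates : Subset n → Fin n → Fin n → Set
  Separates S x y = (x ∈ S × y ∉ S) ⊎ (x ∉ S × y ∈ S)

  Crosses : Subset n → Fin m → Set
  Crosses S f = Separates S (proj₁ (ends f)) (proj₂ (ends f))

  ∈δ⁻ : ∀ G S {f} → f ∈ δ ends G S → f ∈ edges G × Crosses S f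
  ∈δ⁻ G S {f} f∈δ
    with lookup (edges G) f in f∈G | lookup S (proj₁ (ends f)) in s₁ | lookup S (proj₂ (ends f)) in s₂
       | trans (sym (lookup∘tabulate _ f)) ([]=⇒lookup f∈δ)
  ... | true | true  | false | _ = lookup⇒[]= _ _ f∈G , inj₁ (lookup⇒[]= _ _ s₁ , lookup≡false⇒∉ s₂)
  ... | true | false | true  | _ = lookup⇒[]= _ _ f∈G , inj₂ (lookup≡false⇒∉ s₁ , lookup⇒[]= _ _ s₂)
  ... | true | true  | true  | ()
  ... | true | false | false | ()
  ... | false | _    | _     | ()

  ∈δ⁺ : ∀ G S {f} → f ∈ edges G → Crosses S f → f ∈ δ ends G S
  ∈δ⁺ G S {f} f∈G crosses = lookup⇒[]= _ _ (trans (lookup∘tabulate _ f) (lookup-δ crosses))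
    where
    lookup-δ : Crosses S f →
      lookup (edges G) f ∧ (lookup S (proj₁ (ends f)) xor lookup S (proj₂ (ends f))) ≡ true
    lookup-δ (inj₁ (a∈ , b∉)) rewrite []=⇒lookup f∈G | []=⇒lookup a∈ | ∉⇒lookup≡false b∉ = refl
    lookup-δ (inj₂ (a∉ , b∈)) rewrite []=⇒lookup f∈G | ∉⇒lookup≡false a∉ | []=⇒lookup b∈ = refl

  Separates-cong : ∀ {S S' x y} → (x ∈ S ⇔ x ∈ S') → (y ∈ S ⇔ y ∈ S') → Separates S x y → Separates S' x y
  Separates-cong x⇔ y⇔ (inj₁ (x∈ , y∉)) = inj₁ (Equivalence.to x⇔ x∈ , y∉ ∘ Equivalence.from y⇔)
  Separates-cong x⇔ y⇔ (inj₂ (x∉ , y∈)) = inj₂ (x∉ ∘ Equivalence.from x⇔ , Equivalence.to y⇔ y∈)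

  Separates-complement : ∀ {V S x y} → x ∈ V → y ∈ V → Separates S x y → Separates (V ─ S) x y
  Separates-complement x∈V y∈V (inj₁ (x∈ , y∉)) = inj₂ (x∈q⇒x∉p─q x∈ , x∈p─q⁺ y∈V y∉)
  Separates-complement x∈V y∈V (inj₂ (x∉ , y∈)) = inj₁ (x∈p─q⁺ x∈V x∉ , x∈q⇒x∉p─q y∈)

  Separates-complement⁻ : ∀ {V S x y} → x ∈ V → y ∈ V → Separates (V ─ S) x y → Separates S x y
  Separates-complement⁻ x∈V y∈V (inj₁ (x∈ , y∉)) = inj₂ (x∈p─q⇒x∉q x∈ , x∈p∧x∉p─q⇒x∈q y∈V y∉)
  Separates-complement⁻ x∈V y∈V (inj₂ (x∉ , y∈)) = inj₁ (x∈p∧x∉p─q⇒x∈q x∈V x∉ , x∈p─q⇒x∉q y∈)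

  δ-complement : ∀ {G S} → WellFormed ends G → δ ends G S ≡ δ ends G (verts G ─ S)
  δ-complement {G} wf = ⊆-antisym
    (λ f∈ → let f∈G , crosses = ∈δ⁻ G _ f∈ ; a∈ , b∈ = wf _ f∈G in
            ∈δ⁺ G _ f∈G (Separates-complement a∈ b∈ crosses))
    (λ f∈ → let f∈G , crosses = ∈δ⁻ G _ f∈ ; a∈ , b∈ = wf _ f∈G in
            ∈δ⁺ G _ f∈G (Separates-complement⁻ a∈ b∈ crosses))

  δ-cong : ∀ {G S S'} → WellFormed ends G → (∀ {x} → x ∈ verts G → x ∈ S ⇔ x ∈ S') → δ ends G S ≡ δ ends G S'
  δ-cong {G} wf agree = ⊆-antisym
    (λ f∈ → let f∈G , crosses = ∈δ⁻ G _ f∈ ; a∈ , b∈ = wf _ f∈G in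
            ∈δ⁺ G _ f∈G (Separates-cong (agree a∈) (agree b∈) crosses))
    (λ f∈ → let f∈G , crosses = ∈δ⁻ G _ f∈ ; a∈ , b∈ = wf _ f∈G in
            ∈δ⁺ G _ f∈G (Separates-cong (⇔-sym (agree a∈)) (⇔-sym (agree b∈)) crosses))

  -- Walks

  Joins-sym : ∀ {f x y} → Joins ends f x y → Joins ends f y x
  Joins-sym (inj₁ p) = inj₂ p
  Joins-sym (inj₂ p) = inj₁ p

  Joins-∈verts : ∀ {G f x y} → WellFormed ends G → f ∈ edges G → Joins ends f x y → x ∈ verts G × y ∈ verts G
  Joins-∈verts wf f∈G (inj₁ refl) = wf _ f∈G
  Joins-∈verts wf f∈G (inj₂ refl) = let a∈ , b∈ = wf _ f∈G in b∈ , a∈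

  Joins-∈ : ∀ {S f x y} → Joins ends f x y → x ∈ S → y ∈ S → proj₁ (ends f) ∈ S × proj₂ (ends f) ∈ S
  Joins-∈ (inj₁ refl) x∈S y∈S = x∈S , y∈S
  Joins-∈ (inj₂ refl) x∈S y∈S = y∈S , x∈S

  Joins-unique : ∀ {f x y a b} → Joins ends f x y → Joins ends f a b → (a ≡ x × b ≡ y) ⊎ (a ≡ y × b ≡ x)
  Joins-unique (inj₁ refl) (inj₁ eq) = inj₁ (cong proj₁ (sym eq) , cong proj₂ (sym eq))
  Joins-unique (inj₁ refl) (inj₂ eq) = inj₂ (cong proj₂ (sym eq) , cong proj₁ (sym eq))
  Joins-unique (inj₂ refl) (inj₁ eq) = inj₂ (cong proj₁ (sym eq) , cong proj₂ (sym eq))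
  Joins-unique (inj₂ refl) (inj₂ eq) = inj₁ (cong proj₂ (sym eq) , cong proj₁ (sym eq))

  Crosses-Joins : ∀ {S f} → Crosses S f → ∃[ x ] ∃[ y ] Joins ends f x y × x ∈ S × y ∉ S
  Crosses-Joins (inj₁ (a∈ , b∉)) = _ , _ , inj₁ refl , a∈ , b∉
  Crosses-Joins (inj₂ (a∉ , b∈)) = _ , _ , inj₂ refl , b∈ , a∉

  edge-Reach : ∀ {G S f x y} → f ∈ edges G → Joins ends f x y → y ∈ S → Reach ends G S x y
  edge-Reach f∈G j y∈S = step _ f∈G j y∈S here

  Reach-trans : ∀ {G S x y z} → Reach ends G S x y → Reach ends G S y z → Reach ends G S x z
  Reach-trans here q = q
  Reach-trans (step f f∈G j y∈S p) q = step f f∈G j y∈S (Reach-trans p q)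

  Reach-sym : ∀ {G S x y} → x ∈ S → Reach ends G S x y → Reach ends G S y x
  Reach-sym x∈S here = here
  Reach-sym x∈S (step f f∈G j y∈S p) = Reach-trans (Reach-sym y∈S p) (edge-Reach f∈G (Joins-sym j) x∈S)

  Reach-∈ : ∀ {G S x y} → x ∈ S → Reach ends G S x y → y ∈ S
  Reach-∈ x∈S here = x∈S
  Reach-∈ x∈S (step f f∈G j y∈S p) = Reach-∈ y∈S p

  Reach-map : ∀ {G G' S S'} →
    (∀ {f a b} → f ∈ edges G → Joins ends f a b → a ∈ S → b ∈ S → Reach ends G' S' a b) →
    ∀ {x y} → x ∈ S → Reach ends G S x y → Reach ends G' S' x y
  Reach-map edge x∈S here = here
  Reach-map edge x∈S (step f f∈G j y∈S p) = Reach-trans (edge f∈G j x∈S y∈S) (Reach-map edge y∈S p)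

  Reach-mono : ∀ {G G' S S' x y} → edges G ⊆ edges G' → S ⊆ S' → Reach ends G S x y → Reach ends G' S' x y
  Reach-mono E⊆ S⊆ here = here
  Reach-mono E⊆ S⊆ (step f f∈G j y∈S p) = step f (E⊆ f∈G) j (S⊆ y∈S) (Reach-mono E⊆ S⊆ p)

  Reach-∩verts : ∀ {G S x y} → WellFormed ends G → Reach ends G S x y → Reach ends G (S ∩ verts G) x y
  Reach-∩verts wf here = here
  Reach-∩verts wf (step f f∈G j y∈S p) =
    step f f∈G j (x∈p∩q⁺ (y∈S , proj₂ (Joins-∈verts wf f∈G j))) (Reach-∩verts wf p)

  Reach-verts : ∀ {G S x y} → WellFormed ends G → Reach ends G S x y → Reach ends G (verts G) x y
  Reach-verts {S = S} wf p = Reach-mono id (p∩q⊆q S _) (Reach-∩verts wf p)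

  Reach-closed : ∀ {G S K x y} → (∀ {f a b} → f ∈ edges G → Joins ends f a b → a ∈ K → b ∈ K) →
    x ∈ K → Reach ends G S x y → Reach ends G K x y
  Reach-closed closed x∈K here = here
  Reach-closed closed x∈K (step f f∈G j _ p) =
    let y∈K = closed f∈G j x∈K in step f f∈G j y∈K (Reach-closed closed y∈K p)

  reach : ∀ {G S x y} → ConnectedOn ends G S → x ∈ S → y ∈ S → Reach ends G S x y
  reach (_ , connected) = connected _ _

  ConnectedOn-hub : ∀ {G S h} → h ∈ S → (∀ {x} → x ∈ S → Reach ends G S x h) → ConnectedOn ends G S
  ConnectedOn-hub h∈S to-h = (_ , h∈S) , λ x y x∈S y∈S → Reach-trans (to-h x∈S) (Reach-sym y∈S (to-h y∈S))

  BondCut-complement : ∀ {G S} → BondCut ends G S → BondCut ends G (verts G ─ S)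
  BondCut-complement {G} {S} (S⊆V , connected-S , connected-V─S) =
    p─q⊆p (verts G) S , connected-V─S , subst (ConnectedOn ends G) (sym (p─[p─q]≡q S⊆V)) connected-S

  Bonds⇒BondsSame⊎BondsSep : ∀ {G u v C} → u ∈ verts G → v ∈ verts G →
    Bonds ends G C → (BondsSame ends G u v ∪ᶠ BondsSep ends G u v) C
  Bonds⇒BondsSame⊎BondsSep {u = u} {v} u∈V v∈V (S , bond , C≡) with u ∈? S | v ∈? S
  ... | yes u∈S | yes v∈S = inj₁ (S , bond , C≡ , inj₁ (u∈S , v∈S))
  ... | no  u∉S | no  v∉S = inj₁ (S , bond , C≡ , inj₂ (x∈p─q⁺ u∈V u∉S , x∈p─q⁺ v∈V v∉S))
  ... | yes u∈S | no  v∉S = inj₂ (S , bond , C≡ , inj₁ (u∈S , x∈p─q⁺ v∈V v∉S))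
  ... | no  u∉S | yes v∈S = inj₂ (S , bond , C≡ , inj₂ (v∈S , x∈p─q⁺ u∈V u∉S))

  BondsSame⇒Bonds : ∀ {G u v C} → BondsSame ends G u v C → Bonds ends G C
  BondsSame⇒Bonds (S , bond , C≡ , _) = S , bond , C≡

  BondsSep⇒Bonds : ∀ {G u v C} → BondsSep ends G u v C → Bonds ends G C
  BondsSep⇒Bonds (S , bond , C≡ , _) = S , bond , C≡

  BondsSep-irrefl : ∀ {G u C} → ¬ BondsSep ends G u u C
  BondsSep-irrefl (_ , _ , _ , inj₁ (u∈S , u∈V─S)) = x∈p─q⇒x∉q u∈V─S u∈S
  BondsSep-irrefl (_ , _ , _ , inj₂ (u∈S , u∈V─S)) = x∈p─q⇒x∉q u∈V─S u∈S

  Bonds⇒BondsSame-refl : ∀ {G u C} → u ∈ verts G → Bonds ends G C → BondsSame ends G u u C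
  Bonds⇒BondsSame-refl u∈V bond = [ id , ⊥-elim ∘ BondsSep-irrefl ] (Bonds⇒BondsSame⊎BondsSep u∈V u∈V bond)

  BondsSame⇒avoiding : ∀ {G u v C} → WellFormed ends G → BondsSame ends G u v C →
    ∃[ T ] BondCut ends G T × C ≡ δ ends G T × u ∉ T × v ∉ T
  BondsSame⇒avoiding wf (S , bond , C≡ , inj₁ (u∈S , v∈S)) =
    _ , BondCut-complement bond , trans C≡ (δ-complement wf) , x∈q⇒x∉p─q u∈S , x∈q⇒x∉p─q v∈S
  BondsSame⇒avoiding wf (S , bond , C≡ , inj₂ (u∈V─S , v∈V─S)) =
    S , bond , C≡ , x∈p─q⇒x∉q u∈V─S , x∈p─q⇒x∉q v∈V─S

  BondsSep⇒oriented : ∀ {G u v C} → WellFormed ends G → BondsSep ends G u v C →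
    ∃[ T ] BondCut ends G T × C ≡ δ ends G T × u ∈ T × v ∉ T
  BondsSep⇒oriented wf (S , bond , C≡ , inj₁ (u∈S , v∈V─S)) = S , bond , C≡ , u∈S , x∈p─q⇒x∉q v∈V─S
  BondsSep⇒oriented wf (S , bond , C≡ , inj₂ (v∈S , u∈V─S)) =
    _ , BondCut-complement bond , trans C≡ (δ-complement wf) , u∈V─S , x∈q⇒x∉p─q v∈S

  Attached : Graph n m → Fin n → Fin n → Set
  Attached G u v = ∀ {x} → x ∈ verts G → Reach ends G (verts G) x u ⊎ Reach ends G (verts G) x v

  Connected⇒Attached : ∀ {G u v} → Connected ends G → u ∈ verts G → Attached G u v
  Connected⇒Attached connected u∈V x∈V = inj₁ (reach connected x∈V u∈V)

  Connected-attached : ∀ {G u v} → u ∈ verts G → Attached G u v → Reach ends G (verts G) u v →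
    Connected ends G
  Connected-attached u∈V attached u⇝v =
    ConnectedOn-hub u∈V (λ x∈V → [ id , (λ x⇝v → Reach-trans x⇝v (Reach-sym u∈V u⇝v)) ] (attached x∈V))

  wf-∖ₑ : ∀ {G} e → WellFormed ends G → WellFormed ends (G ∖ₑ e)
  wf-∖ₑ {G} e wf f f∈ = wf f (p─q⊆p (edges G) ⁅ e ⁆ f∈)

  Reach-∖ₑ : ∀ {G S e u v x y} → Joins ends e u v → Reach ends G S x y →
    Reach ends (G ∖ₑ e) S x y ⊎ Reach ends (G ∖ₑ e) S x u ⊎ Reach ends (G ∖ₑ e) S x v
  Reach-∖ₑ je here = inj₁ here
  Reach-∖ₑ {G} {S} {e} je (step {x} f f∈G j y∈S p) with f ≟ e
  ... | yes refl = [ (λ { (refl , _) → inj₂ (inj₁ here) }) , (λ { (refl , _) → inj₂ (inj₂ here) }) ]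
                     (Joins-unique je j)
  ... | no  f≢e  = Sum.map extend (Sum.map extend extend) (Reach-∖ₑ je p)
    where
    extend : ∀ {z} → Reach ends (G ∖ₑ e) S _ z → Reach ends (G ∖ₑ e) S x z
    extend = step f (x∈p∧x≢y⇒x∈p-y f∈G f≢e) j y∈S

  ∖ₑ-attached : ∀ {G e u v} → Connected ends G → Joins ends e u v → u ∈ verts G → Attached (G ∖ₑ e) u v
  ∖ₑ-attached connected je u∈V x∈V = [ inj₁ , id ] (Reach-∖ₑ je (reach connected x∈V u∈V))

  -- Deciding reachability

  Reach-last-visit : ∀ {G S x y} c → Reach ends G S x y → Reach ends G (S - c) x y ⊎ Reach ends G (S - c) c y
  Reach-last-visit c here = inj₁ here
  Reach-last-visit c (step {y = b} f f∈G j b∈S p) with Reach-last-visit c p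
  ... | inj₂ q = inj₂ q
  ... | inj₁ q with b ≟ c
  ...   | yes refl = inj₂ q
  ...   | no  b≢c  = inj₁ (step f f∈G j (x∈p∧x≢y⇒x∈p-y b∈S b≢c) q)

  Reach-unfold : ∀ {G S x y} → Reach ends G S x y ⇔
    (x ≡ y ⊎ ∃[ f ] ∃[ b ] f ∈ edges G × Joins ends f x b × b ∈ S × Reach ends G (S - b) b y)
  Reach-unfold {G} {S} = mk⇔ to from
    where
    to : ∀ {x y} → Reach ends G S x y →
      x ≡ y ⊎ ∃[ f ] ∃[ b ] f ∈ edges G × Joins ends f x b × b ∈ S × Reach ends G (S - b) b y
    to here = inj₁ refl
    to (step {y = b} f f∈G j b∈S p) = inj₂ (f , b , f∈G , j , b∈S , Sum.reduce (Reach-last-visit b p))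
    from : ∀ {x y} → x ≡ y ⊎ ∃[ f ] ∃[ b ] f ∈ edges G × Joins ends f x b × b ∈ S × Reach ends G (S - b) b y →
      Reach ends G S x y
    from (inj₁ refl) = here
    from (inj₂ (f , b , f∈G , j , b∈S , p)) = step f f∈G j b∈S (Reach-mono id (p─q⊆p S ⁅ b ⁆) p)

  -- By recursion on ∣ S ∣: after its first step x → b a walk can be taken to avoid b (Reach-last-visit).
  reach? : ∀ G S x y → Dec (Reach ends G S x y)
  reach? G S = bounded ∣ S ∣ S ≤-refl
    where
    Joins? : ∀ f x y → Dec (Joins ends f x y)
    Joins? f x y = ≡-dec _≟_ _≟_ (ends f) (x , y) ⊎-dec ≡-dec _≟_ _≟_ (ends f) (y , x)
    bounded : ∀ k S → ∣ S ∣ ≤ k → ∀ x y → Dec (Reach ends G S x y)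
    next? : ∀ k {S} → ∣ S ∣ ≤ k → ∀ b y → Dec (b ∈ S × Reach ends G (S - b) b y)
    next? k {S} ∣S∣≤k b y with b ∈? S
    next? k       ∣S∣≤k b y | no b∉S = no (b∉S ∘ proj₁)
    next? zero    ∣S∣≤0 b y | yes b∈S = ⊥-elim (n≮0 (<-≤-trans (x∈p⇒∣p-x∣<∣p∣ b∈S) ∣S∣≤0))
    next? (suc k) {S} ∣S∣≤k b y | yes b∈S =
      map′ (b∈S ,_) proj₂ (bounded k (S - b) (≤-pred (<-≤-trans (x∈p⇒∣p-x∣<∣p∣ b∈S) ∣S∣≤k)) b y)
    bounded k S ∣S∣≤k x y = map′ (Equivalence.from Reach-unfold) (Equivalence.to Reach-unfold)
      (x ≟ y ⊎-dec any? λ f → any? λ b → f ∈? edges G ×-dec Joins? f x b ×-dec next? k ∣S∣≤k b y)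

  component : Graph n m → Fin n → Subset n
  component G x = tabulate λ y → does (reach? G (verts G) x y)

  ∈component⁺ : ∀ {G x y} → Reach ends G (verts G) x y → y ∈ component G x
  ∈component⁺ {G} {x} {y} p =
    lookup⇒[]= y _
      (trans (lookup∘tabulate (λ z → does (reach? G (verts G) x z)) y) (dec-true (reach? G (verts G) x y) p))

  ∈component⁻ : ∀ {G x y} → y ∈ component G x → Reach ends G (verts G) x y
  ∈component⁻ {G} {x} {y} y∈ =
    witness (reach? G (verts G) x y)
      (trans (sym (lookup∘tabulate (λ z → does (reach? G (verts G) x z)) y)) ([]=⇒lookup y∈))
    where
    witness : ∀ {P : Set} (P? : Dec P) → does P? ≡ true → P
    witness (yes p) _ = p
    witness (no _) ()

  BondsSep-∅ : ∀ {G u v} → WellFormed ends G → u ∈ verts G → v ∈ verts G → Attached G u v →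
    ¬ Reach ends G (verts G) u v → BondsSep ends G u v ∅
  BondsSep-∅ {G} {u} {v} wf u∈V v∈V attached u⇸v =
    U , (U⊆V , ConnectedOn-hub u∈U to-u , ConnectedOn-hub v∈V─U to-v) , sym δ≡∅ , inj₁ (u∈U , v∈V─U)
    where
    V = verts G
    U = component G u
    u∈U = ∈component⁺ here
    v∈V─U = x∈p─q⁺ v∈V (u⇸v ∘ ∈component⁻)
    U⊆V : U ⊆ V
    U⊆V = Reach-∈ u∈V ∘ ∈component⁻
    U-closed : ∀ {f a b} → f ∈ edges G → Joins ends f a b → a ∈ U → b ∈ U
    U-closed f∈G j a∈U =
      ∈component⁺ (Reach-trans (∈component⁻ a∈U) (edge-Reach f∈G j (proj₂ (Joins-∈verts wf f∈G j))))
    V─U-closed : ∀ {f a b} → f ∈ edges G → Joins ends f a b → a ∈ V ─ U → b ∈ V ─ U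
    V─U-closed f∈G j a∈ = x∈p─q⁺ (proj₂ (Joins-∈verts wf f∈G j)) (x∈p─q⇒x∉q a∈ ∘ U-closed f∈G (Joins-sym j))
    to-u : ∀ {x} → x ∈ U → Reach ends G U x u
    to-u x∈U = Reach-sym u∈U (Reach-closed U-closed u∈U (∈component⁻ x∈U))
    to-v : ∀ {x} → x ∈ V ─ U → Reach ends G (V ─ U) x v
    to-v x∈ with attached (proj₁ (x∈p─q⁻ V U x∈))
    ... | inj₁ x⇝u = ⊥-elim (x∈p─q⇒x∉q x∈ (∈component⁺ (Reach-sym (proj₁ (x∈p─q⁻ V U x∈)) x⇝u)))
    ... | inj₂ x⇝v = Reach-closed V─U-closed x∈ x⇝v
    δ≡∅ : δ ends G U ≡ ∅
    δ≡∅ = ⊆-antisym (λ f∈ → let f∈G , crosses = ∈δ⁻ G U f∈ ; _ , _ , j , a∈U , b∉U = Crosses-Joins crosses in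
                             ⊥-elim (b∉U (U-closed f∈G j a∈U)))
                    ⊥⊆

  BondsSep⇒∅ : ∀ {G u v C} → WellFormed ends G → v ∈ verts G → ¬ Reach ends G (verts G) u v →
    BondsSep ends G u v C → C ≡ ∅
  BondsSep⇒∅ {G} wf v∈V u⇸v sep with BondsSep⇒oriented wf sep
  ... | T , (T⊆V , connected-T , connected-V─T) , refl , u∈T , v∉T = ⊆-antisym no-crossing ⊥⊆
    where
    no-crossing : δ ends G T ⊆ ∅
    no-crossing f∈ = let f∈G , crosses = ∈δ⁻ G T f∈ ; _ , _ , j , a∈T , b∉T = Crosses-Joins crosses
                         b∈V = proj₂ (Joins-∈verts wf f∈G j) in
      ⊥-elim (u⇸v (Reach-trans (Reach-mono id T⊆V (reach connected-T u∈T a∈T))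
                   (step _ f∈G j b∈V (Reach-mono id (p─q⊆p (verts G) T)
                     (reach connected-V─T (x∈p─q⁺ b∈V b∉T) (x∈p─q⁺ v∈V v∉T))))))

  -- Gluing two graphs along {u, v}

  -- u ≡ v is allowed: this is then a 1-sum.
  record Gluing : Set where
    field
      A B H : Graph n m
      u v : Fin n
      wf-A : WellFormed ends A
      wf-B : WellFormed ends B
      verts-H⁺ : ∀ {x} → x ∈ verts A ⊎ x ∈ verts B → x ∈ verts H
      verts-H⁻ : ∀ {x} → x ∈ verts H → x ∈ verts A ⊎ x ∈ verts B
      edges-H⁺ : ∀ {f} → f ∈ edges A ⊎ f ∈ edges B → f ∈ edges H
      edges-H⁻ : ∀ {f} → f ∈ edges H → f ∈ edges A ⊎ f ∈ edges B
      shared : ∀ {x} → x ∈ verts A → x ∈ verts B → x ≡ u ⊎ x ≡ v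
      u∈A : u ∈ verts A
      u∈B : u ∈ verts B
      v∈A : v ∈ verts A
      v∈B : v ∈ verts B

  swap : Gluing → Gluing
  swap Γ = record
    { A = B ; B = A ; H = H ; u = u ; v = v ; wf-A = wf-B ; wf-B = wf-A
    ; verts-H⁺ = verts-H⁺ ∘ ⊎-swap ; verts-H⁻ = ⊎-swap ∘ verts-H⁻
    ; edges-H⁺ = edges-H⁺ ∘ ⊎-swap ; edges-H⁻ = ⊎-swap ∘ edges-H⁻
    ; shared = flip shared ; u∈A = u∈B ; u∈B = u∈A ; v∈A = v∈B ; v∈B = v∈A }
    where open Gluing Γ

  module _ (Γ : Gluing) where
    open Gluing Γ

    -- K is A together with edges parallel to uv that stand in for the u–v walks of B.
    record Completion : Set where
      field
        edges-K : Subset m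
        A⊆K : edges A ⊆ edges-K
        K⊆A+uv : ∀ {f} → f ∈ edges-K → f ∈ edges A ⊎ (Joins ends f u v × Reach ends B (verts B) u v)
        shortcut : Reach ends B (verts B) u v → u ≡ v ⊎ ∃[ f ] f ∈ edges-K × Joins ends f u v
        attached : Attached B u v

      K : Graph n m
      K = graph (verts A) edges-K

    plain-completion : (Reach ends B (verts B) u v → u ≡ v ⊎ ∃[ f ] f ∈ edges A × Joins ends f u v) →
      Attached B u v → Completion
    plain-completion shortcut attached =
      record { edges-K = edges A ; A⊆K = id ; K⊆A+uv = inj₁ ; shortcut = shortcut ; attached = attached }

    edge-completion : ∀ {E e} → edges A ⊆ E → (∀ {f} → f ∈ E → f ≢ e → f ∈ edges A) → e ∈ E →
      Joins ends e u v → Reach ends B (verts B) u v → Attached B u v → Completion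
    edge-completion {E} {e} A⊆E E-e⊆A e∈E je u⇝v attached = record
      { edges-K = E ; A⊆K = A⊆E ; K⊆A+uv = K⊆A+uv
      ; shortcut = λ _ → inj₂ (e , e∈E , je) ; attached = attached }
      where
      K⊆A+uv : ∀ {f} → f ∈ E → f ∈ edges A ⊎ (Joins ends f u v × Reach ends B (verts B) u v)
      K⊆A+uv {f} f∈E with f ≟ e
      ... | yes refl = inj₂ (je , u⇝v)
      ... | no  f≢e  = inj₁ (E-e⊆A f∈E f≢e)

  module OneSide (Γ : Gluing) where
    open Gluing Γ

    wf-H : WellFormed ends H
    wf-H f f∈H with edges-H⁻ f∈H
    ... | inj₁ f∈A = let a∈ , b∈ = wf-A f f∈A in verts-H⁺ (inj₁ a∈) , verts-H⁺ (inj₁ b∈)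
    ... | inj₂ f∈B = let a∈ , b∈ = wf-B f f∈B in verts-H⁺ (inj₂ a∈) , verts-H⁺ (inj₂ b∈)

    uv∉ : ∀ {R x} → u ∉ R → v ∉ R → x ≡ u ⊎ x ≡ v → x ∉ R
    uv∉ u∉R v∉R (inj₁ refl) = u∉R
    uv∉ u∉R v∉R (inj₂ refl) = v∉R

    not-shared : ∀ {R x} → u ∉ R → v ∉ R → x ∈ R → x ∈ verts A → x ∉ verts B
    not-shared u∉R v∉R x∈R x∈A x∈B = uv∉ u∉R v∉R (shared x∈A x∈B) x∈R

    Reach-H-stays-in-A : ∀ {R x y} → u ∉ R → v ∉ R → x ∈ R → x ∈ verts A → Reach ends H R x y → y ∈ verts A
    Reach-H-stays-in-A u∉R v∉R x∈R x∈A here = x∈A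
    Reach-H-stays-in-A u∉R v∉R x∈R x∈A (step f f∈H j y∈R p) with edges-H⁻ f∈H
    ... | inj₁ f∈A = Reach-H-stays-in-A u∉R v∉R y∈R (proj₂ (Joins-∈verts wf-A f∈A j)) p
    ... | inj₂ f∈B = ⊥-elim (not-shared u∉R v∉R x∈R x∈A (proj₁ (Joins-∈verts wf-B f∈B j)))

    Reach-project : ∀ {K R} → edges A ⊆ edges K →
      (u ∈ R → v ∈ R → Reach ends B R u v → Reach ends K R u v) →
      ∀ {x y} → x ∈ R → x ∈ verts A → y ∈ verts A → Reach ends H R x y → Reach ends K R x y
    Reach-project {K} {R} A⊆K uv-bridge x∈R x∈A y∈A p = proj₁ (project x∈R y∈A p) x∈A
      where
      bridge : ∀ {b b'} → b ∈ R → b' ∈ R → b ∈ verts A → b ∈ verts B → b' ∈ verts A → b' ∈ verts B →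
        Reach ends B R b b' → Reach ends K R b b'
      bridge b∈R b'∈R b∈A b∈B b'∈A b'∈B with shared b∈A b∈B | shared b'∈A b'∈B
      ... | inj₁ refl | inj₁ refl = λ _ → here
      ... | inj₂ refl | inj₂ refl = λ _ → here
      ... | inj₁ refl | inj₂ refl = uv-bridge b∈R b'∈R
      ... | inj₂ refl | inj₁ refl = Reach-sym b'∈R ∘ uv-bridge b'∈R b∈R ∘ Reach-sym b∈R

      Exit : Fin n → Fin n → Set
      Exit x y = ∃[ b ] b ∈ R × b ∈ verts A × b ∈ verts B × Reach ends B R x b × Reach ends K R b y

      -- Induction along the walk: from a vertex of B the walk re-enters A at a shared vertex b.
      project : ∀ {x y} → x ∈ R → y ∈ verts A → Reach ends H R x y →
        (x ∈ verts A → Reach ends K R x y) × (x ∈ verts B → Exit x y)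
      project x∈R y∈A here = (λ _ → here) , λ y∈B → _ , x∈R , y∈A , y∈B , here , here
      project x∈R y∈A (step f f∈H j x'∈R p) with project x'∈R y∈A p | edges-H⁻ f∈H
      ... | via-A , _ | inj₁ f∈A =
        let x∈A , x'∈A = Joins-∈verts wf-A f∈A j
            K-path = step f (A⊆K f∈A) j x'∈R (via-A x'∈A)
        in (λ _ → K-path) , λ x∈B → _ , x∈R , x∈A , x∈B , here , K-path
      ... | _ , via-B | inj₂ f∈B =
        let x∈B , x'∈B = Joins-∈verts wf-B f∈B j
            b , b∈R , b∈A , b∈B , B-path , K-path = via-B x'∈B
            B-path' = step f f∈B j x'∈R B-path
        in (λ x∈A → Reach-trans (bridge x∈R b∈R x∈A x∈B b∈A b∈B B-path') K-path) ,
           λ _ → b , b∈R , b∈A , b∈B , B-path' , K-path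

    H-bond⇒BondsSep-A : ∀ {S} → BondCut ends H S → u ∈ S → v ∉ S →
      BondsSep ends A u v (δ ends A (S ∩ verts A))
    H-bond⇒BondsSep-A {S} (S⊆H , connected-S , connected-R) u∈S v∉S =
      S ∩ verts A , (p∩q⊆q S (verts A) , ConnectedOn-hub u∈S∩A to-u , ConnectedOn-hub v∈A─S to-v) , refl ,
      inj₁ (u∈S∩A , v∈A─S)
      where
      u∈S∩A = x∈p∩q⁺ (u∈S , u∈A)
      v∈A─S = x∈p─q⁺ v∈A (v∉S ∘ proj₁ ∘ x∈p∩q⁻ S (verts A))
      R = verts H ─ S
      to-u : ∀ {x} → x ∈ S ∩ verts A → Reach ends A (S ∩ verts A) x u
      to-u x∈ = let x∈S , x∈A = x∈p∩q⁻ S (verts A) x∈ in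
        Reach-∩verts wf-A (Reach-project id (λ _ v∈S → ⊥-elim (v∉S v∈S)) x∈S x∈A u∈A
          (reach connected-S x∈S u∈S))
      to-v : ∀ {x} → x ∈ verts A ─ (S ∩ verts A) → Reach ends A (verts A ─ (S ∩ verts A)) x v
      to-v x∈ = let x∈A , x∉S∩A = x∈p─q⁻ (verts A) (S ∩ verts A) x∈
                    x∈R = x∈p─q⁺ (verts-H⁺ (inj₁ x∈A)) (λ x∈S → x∉S∩A (x∈p∩q⁺ (x∈S , x∈A)))
                    v∈R = x∈p─q⁺ (verts-H⁺ (inj₁ v∈A)) v∉S in
        Reach-mono id R∩A⊆A─S
          (Reach-∩verts wf-A (Reach-project id (λ u∈R _ → ⊥-elim (x∈q⇒x∉p─q u∈S u∈R)) x∈R x∈A v∈A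
            (reach connected-R x∈R v∈R)))
        where
        R∩A⊆A─S : R ∩ verts A ⊆ verts A ─ (S ∩ verts A)
        R∩A⊆A─S y∈ = let y∈R , y∈A = x∈p∩q⁻ R (verts A) y∈ in
          x∈p─q⁺ y∈A (x∈p─q⇒x∉q y∈R ∘ proj₁ ∘ x∈p∩q⁻ S (verts A))

    module _ (c : Completion Γ) where
      open Completion c

      wf-K : WellFormed ends K
      wf-K f f∈K with K⊆A+uv f∈K
      ... | inj₁ f∈A = wf-A f f∈A
      ... | inj₂ (j , _) = Joins-∈ j u∈A v∈A

      δ-H≡δ-K : ∀ {T} → T ⊆ verts A → u ∉ T → v ∉ T → δ ends H T ≡ δ ends K T
      δ-H≡δ-K {T} T⊆A u∉T v∉T = ⊆-antisym H⊆K K⊆H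
        where
        H⊆K : δ ends H T ⊆ δ ends K T
        H⊆K f∈ with ∈δ⁻ H T f∈
        ... | f∈H , crosses with Crosses-Joins crosses | edges-H⁻ f∈H
        ... | _ | inj₁ f∈A = ∈δ⁺ K T (A⊆K f∈A) crosses
        ... | _ , _ , j , x∈T , _ | inj₂ f∈B =
          ⊥-elim (not-shared u∉T v∉T x∈T (T⊆A x∈T) (proj₁ (Joins-∈verts wf-B f∈B j)))
        K⊆H : δ ends K T ⊆ δ ends H T
        K⊆H f∈ with ∈δ⁻ K T f∈
        ... | f∈K , crosses with Crosses-Joins crosses | K⊆A+uv f∈K
        ... | _ | inj₁ f∈A = ∈δ⁺ H T (edges-H⁺ (inj₁ f∈A)) crosses
        ... | _ , _ , j , x∈T , _ | inj₂ (j-uv , _) =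
          ⊥-elim (uv∉ u∉T v∉T (Sum.map proj₁ proj₁ (Joins-unique j-uv j)) x∈T)

      H-bond⇒K-bond : ∀ {T} → BondCut ends H T → T ⊆ verts A → u ∉ T → v ∉ T → BondCut ends K T
      H-bond⇒K-bond {T} (_ , connected-T , connected-R) T⊆A u∉T v∉T =
        T⊆A , (proj₁ connected-T , λ x y x∈ y∈ → Reach-map H-step x∈ (reach connected-T x∈ y∈)) ,
        ConnectedOn-hub (x∈p─q⁺ u∈A u∉T) to-u
        where
        H-step : ∀ {f a b} → f ∈ edges H → Joins ends f a b → a ∈ T → b ∈ T → Reach ends K T a b
        H-step f∈H j a∈T b∈T with edges-H⁻ f∈H
        ... | inj₁ f∈A = edge-Reach (A⊆K f∈A) j b∈T
        ... | inj₂ f∈B = ⊥-elim (not-shared u∉T v∉T b∈T (T⊆A b∈T) (proj₂ (Joins-∈verts wf-B f∈B j)))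
        R = verts H ─ T
        uv-bridge : u ∈ R → v ∈ R → Reach ends B R u v → Reach ends K R u v
        uv-bridge _ v∈R p with shortcut (Reach-verts wf-B p)
        ... | inj₁ u≡v = subst (Reach ends K R u) u≡v here
        ... | inj₂ (f , f∈K , j) = edge-Reach f∈K j v∈R
        R∩A⊆A─T : R ∩ verts A ⊆ verts A ─ T
        R∩A⊆A─T y∈ = let y∈R , y∈A = x∈p∩q⁻ R (verts A) y∈ in x∈p─q⁺ y∈A (x∈p─q⇒x∉q y∈R)
        to-u : ∀ {x} → x ∈ verts A ─ T → Reach ends K (verts A ─ T) x u
        to-u x∈ = let x∈A , x∉T = x∈p─q⁻ (verts A) T x∈
                      x∈R = x∈p─q⁺ (verts-H⁺ (inj₁ x∈A)) x∉T
                      u∈R = x∈p─q⁺ (verts-H⁺ (inj₁ u∈A)) u∉T in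
          Reach-mono id R∩A⊆A─T
            (Reach-∩verts wf-K (Reach-project A⊆K uv-bridge x∈R x∈A u∈A (reach connected-R x∈R u∈R)))

      K-bond⇒H-bond : ∀ {T} → BondCut ends K T → u ∉ T → v ∉ T → BondCut ends H T
      K-bond⇒H-bond {T} (T⊆A , connected-T , connected-A─T) u∉T v∉T =
        verts-H⁺ ∘ inj₁ ∘ T⊆A ,
        (proj₁ connected-T , λ x y x∈ y∈ → Reach-map K-step x∈ (reach connected-T x∈ y∈)) ,
        ConnectedOn-hub (A─T⊆R u∈A─T) to-u
        where
        K-step : ∀ {f a b} → f ∈ edges K → Joins ends f a b → a ∈ T → b ∈ T → Reach ends H T a b
        K-step f∈K j a∈T b∈T with K⊆A+uv f∈K
        ... | inj₁ f∈A = edge-Reach (edges-H⁺ (inj₁ f∈A)) j b∈T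
        ... | inj₂ (j-uv , _) = ⊥-elim (uv∉ u∉T v∉T (Sum.map proj₁ proj₁ (Joins-unique j-uv j)) a∈T)
        R = verts H ─ T
        u∈A─T = x∈p─q⁺ u∈A u∉T
        v∈A─T = x∈p─q⁺ v∈A v∉T
        A─T⊆R : verts A ─ T ⊆ R
        A─T⊆R y∈ = let y∈A , y∉T = x∈p─q⁻ (verts A) T y∈ in x∈p─q⁺ (verts-H⁺ (inj₁ y∈A)) y∉T
        B⊆R : verts B ⊆ R
        B⊆R y∈B = x∈p─q⁺ (verts-H⁺ (inj₂ y∈B)) (λ y∈T → not-shared u∉T v∉T y∈T (T⊆A y∈T) y∈B)
        via-B : ∀ {x y} → Reach ends B (verts B) x y → Reach ends H R x y
        via-B = Reach-mono (edges-H⁺ ∘ inj₂) B⊆R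
        K-step-outside : ∀ {f a b} → f ∈ edges K → Joins ends f a b → a ∈ verts A ─ T → b ∈ verts A ─ T →
          Reach ends H R a b
        K-step-outside f∈K j a∈ b∈ with K⊆A+uv f∈K
        ... | inj₁ f∈A = edge-Reach (edges-H⁺ (inj₁ f∈A)) j (A─T⊆R b∈)
        ... | inj₂ (j-uv , u⇝v) with Joins-unique j-uv j
        ...   | inj₁ (refl , refl) = via-B u⇝v
        ...   | inj₂ (refl , refl) = Reach-sym (B⊆R u∈B) (via-B u⇝v)
        via-A : ∀ {x} → x ∈ verts A ─ T → Reach ends H R x u
        via-A x∈ = Reach-map K-step-outside x∈ (reach connected-A─T x∈ u∈A─T)
        to-u : ∀ {x} → x ∈ R → Reach ends H R x u
        to-u x∈R with x∈p─q⁻ (verts H) T x∈R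
        ... | x∈H , x∉T with verts-H⁻ x∈H
        ...   | inj₁ x∈A = via-A (x∈p─q⁺ x∈A x∉T)
        ...   | inj₂ x∈B with attached x∈B
        ...     | inj₁ x⇝u = via-B x⇝u
        ...     | inj₂ x⇝v = Reach-trans (via-B x⇝v) (via-A v∈A─T)

      H-bond⇒BondsSame-K : ∀ {T} → BondCut ends H T → T ⊆ verts A → u ∉ T → v ∉ T →
        BondsSame ends K u v (δ ends H T)
      H-bond⇒BondsSame-K bond T⊆A u∉T v∉T =
        _ , H-bond⇒K-bond bond T⊆A u∉T v∉T , δ-H≡δ-K T⊆A u∉T v∉T , inj₂ (x∈p─q⁺ u∈A u∉T , x∈p─q⁺ v∈A v∉T)

      BondsSame-K⇒Bonds-H : ∀ {C} → BondsSame ends K u v C → Bonds ends H C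
      BondsSame-K⇒Bonds-H same with BondsSame⇒avoiding wf-K same
      ... | T , bond , refl , u∉T , v∉T = T , K-bond⇒H-bond bond u∉T v∉T , sym (δ-H≡δ-K (proj₁ bond) u∉T v∉T)

  module TwoSides (Γ : Gluing) where
    open Gluing Γ
    private
      module onA = OneSide Γ
      module onB = OneSide (swap Γ)

    inside-one-side : ∀ {T} → T ⊆ verts H → ConnectedOn ends H T → u ∉ T → v ∉ T → T ⊆ verts A ⊎ T ⊆ verts B
    inside-one-side T⊆H ((x , x∈T) , connected) u∉T v∉T with verts-H⁻ (T⊆H x∈T)
    ... | inj₁ x∈A = inj₁ λ y∈T → onA.Reach-H-stays-in-A u∉T v∉T x∈T x∈A (connected _ _ x∈T y∈T)
    ... | inj₂ x∈B = inj₂ λ y∈T → onB.Reach-H-stays-in-A u∉T v∉T x∈T x∈B (connected _ _ x∈T y∈T)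

    δ-H : ∀ S → δ ends H S ≡ δ ends A S ∪ δ ends B S
    δ-H S = ⊆-antisym H⊆A∪B A∪B⊆H
      where
      H⊆A∪B : δ ends H S ⊆ δ ends A S ∪ δ ends B S
      H⊆A∪B f∈ = let f∈H , crosses = ∈δ⁻ H S f∈ in
        x∈p∪q⁺ (Sum.map (λ f∈A → ∈δ⁺ A S f∈A crosses) (λ f∈B → ∈δ⁺ B S f∈B crosses) (edges-H⁻ f∈H))
      A∪B⊆H : δ ends A S ∪ δ ends B S ⊆ δ ends H S
      A∪B⊆H f∈ with x∈p∪q⁻ (δ ends A S) (δ ends B S) f∈
      ... | inj₁ f∈δA = let f∈A , crosses = ∈δ⁻ A S f∈δA in ∈δ⁺ H S (edges-H⁺ (inj₁ f∈A)) crosses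
      ... | inj₂ f∈δB = let f∈B , crosses = ∈δ⁻ B S f∈δB in ∈δ⁺ H S (edges-H⁺ (inj₂ f∈B)) crosses

    δ-H-split : ∀ S → δ ends H S ≡ δ ends A (S ∩ verts A) ∪ δ ends B (S ∩ verts B)
    δ-H-split S =
      trans (δ-H S) (cong₂ _∪_ (δ-cong wf-A (∩-agree (verts A))) (δ-cong wf-B (∩-agree (verts B))))
      where
      ∩-agree : ∀ V {x} → x ∈ V → x ∈ S ⇔ x ∈ S ∩ V
      ∩-agree V x∈V = mk⇔ (λ x∈S → x∈p∩q⁺ (x∈S , x∈V)) (proj₁ ∘ x∈p∩q⁻ S V)

    separating-bonds-glue : ∀ {S₁ S₂} → BondCut ends A S₁ → u ∈ S₁ → v ∉ S₁ →
      BondCut ends B S₂ → u ∈ S₂ → v ∉ S₂ → Bonds ends H (δ ends A S₁ ∪ δ ends B S₂)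
    separating-bonds-glue {S₁} {S₂} (S₁⊆A , connected₁ , connected₁') u∈S₁ v∉S₁
                                    (S₂⊆B , connected₂ , connected₂') u∈S₂ v∉S₂ =
      S , (S⊆H , ConnectedOn-hub (x∈p∪q⁺ (inj₁ u∈S₁)) to-u , ConnectedOn-hub v∈R to-v) ,
      sym (trans (δ-H S) (cong₂ _∪_ (δ-cong wf-A agree-A) (δ-cong wf-B agree-B)))
      where
      S = S₁ ∪ S₂
      R = verts H ─ S
      S⊆H : S ⊆ verts H
      S⊆H = verts-H⁺ ∘ Sum.map S₁⊆A S₂⊆B ∘ x∈p∪q⁻ S₁ S₂
      shared-agree : ∀ {y} → y ∈ verts A → y ∈ verts B → y ∈ S₁ ⇔ y ∈ S₂
      shared-agree y∈A y∈B with shared y∈A y∈B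
      ... | inj₁ refl = mk⇔ (λ _ → u∈S₂) (λ _ → u∈S₁)
      ... | inj₂ refl = mk⇔ (⊥-elim ∘ v∉S₁) (⊥-elim ∘ v∉S₂)
      agree-A : ∀ {y} → y ∈ verts A → y ∈ S ⇔ y ∈ S₁
      agree-A y∈A = mk⇔ ([ id , (λ y∈S₂ → Equivalence.from (shared-agree y∈A (S₂⊆B y∈S₂)) y∈S₂) ]
        ∘ x∈p∪q⁻ S₁ S₂) (x∈p∪q⁺ ∘ inj₁)
      agree-B : ∀ {y} → y ∈ verts B → y ∈ S ⇔ y ∈ S₂
      agree-B y∈B = mk⇔ ([ (λ y∈S₁ → Equivalence.to (shared-agree (S₁⊆A y∈S₁) y∈B) y∈S₁) , id ]
        ∘ x∈p∪q⁻ S₁ S₂) (x∈p∪q⁺ ∘ inj₂)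
      A─S₁⊆R : verts A ─ S₁ ⊆ R
      A─S₁⊆R y∈ = let y∈A , y∉S₁ = x∈p─q⁻ (verts A) S₁ y∈ in
        x∈p─q⁺ (verts-H⁺ (inj₁ y∈A)) (y∉S₁ ∘ Equivalence.to (agree-A y∈A))
      B─S₂⊆R : verts B ─ S₂ ⊆ R
      B─S₂⊆R y∈ = let y∈B , y∉S₂ = x∈p─q⁻ (verts B) S₂ y∈ in
        x∈p─q⁺ (verts-H⁺ (inj₂ y∈B)) (y∉S₂ ∘ Equivalence.to (agree-B y∈B))
      v∈R = A─S₁⊆R (x∈p─q⁺ v∈A v∉S₁)
      to-u : ∀ {x} → x ∈ S → Reach ends H S x u
      to-u x∈S with x∈p∪q⁻ S₁ S₂ x∈S
      ... | inj₁ x∈S₁ = Reach-mono (edges-H⁺ ∘ inj₁) (x∈p∪q⁺ ∘ inj₁) (reach connected₁ x∈S₁ u∈S₁)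
      ... | inj₂ x∈S₂ = Reach-mono (edges-H⁺ ∘ inj₂) (x∈p∪q⁺ ∘ inj₂) (reach connected₂ x∈S₂ u∈S₂)
      to-v : ∀ {x} → x ∈ R → Reach ends H R x v
      to-v x∈R with x∈p─q⁻ (verts H) S x∈R
      ... | x∈H , x∉S with verts-H⁻ x∈H
      ...   | inj₁ x∈A = Reach-mono (edges-H⁺ ∘ inj₁) A─S₁⊆R
                (reach connected₁' (x∈p─q⁺ x∈A (x∉S ∘ x∈p∪q⁺ ∘ inj₁)) (x∈p─q⁺ v∈A v∉S₁))
      ...   | inj₂ x∈B = Reach-mono (edges-H⁺ ∘ inj₂) B─S₂⊆R
                (reach connected₂' (x∈p─q⁺ x∈B (x∉S ∘ x∈p∪q⁺ ∘ inj₂)) (x∈p─q⁺ v∈B v∉S₂))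

    module _ (c₁ : Completion Γ) (c₂ : Completion (swap Γ)) where
      K₁ K₂ : Graph n m
      K₁ = Completion.K c₁
      K₂ = Completion.K c₂

      bonds-of-gluing : Bonds ends H ≈ᶠ
        (BondsSame ends K₁ u v ∪ᶠ BondsSame ends K₂ u v ∪ᶠ (BondsSep ends A u v ⊎ᶠ BondsSep ends B u v))
      bonds-of-gluing C = mk⇔ to from
        where
        to : Bonds ends H C →
          (BondsSame ends K₁ u v ∪ᶠ BondsSame ends K₂ u v ∪ᶠ (BondsSep ends A u v ⊎ᶠ BondsSep ends B u v)) C
        to bond with Bonds⇒BondsSame⊎BondsSep (verts-H⁺ (inj₁ u∈A)) (verts-H⁺ (inj₁ v∈A)) bond
        ... | inj₁ same with BondsSame⇒avoiding onA.wf-H same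
        ...   | T , bond@(T⊆H , connected-T , _) , refl , u∉T , v∉T
          with inside-one-side T⊆H connected-T u∉T v∉T
        ...     | inj₁ T⊆A = inj₁ (onA.H-bond⇒BondsSame-K c₁ bond T⊆A u∉T v∉T)
        ...     | inj₂ T⊆B = inj₂ (inj₁ (onB.H-bond⇒BondsSame-K c₂ bond T⊆B u∉T v∉T))
        to bond | inj₂ sep with BondsSep⇒oriented onA.wf-H sep
        ...   | S , bond , refl , u∈S , v∉S =
          inj₂ (inj₂ (_ , _ , onA.H-bond⇒BondsSep-A bond u∈S v∉S , onB.H-bond⇒BondsSep-A bond u∈S v∉S ,
                      δ-H-split S))
        from :
          (BondsSame ends K₁ u v ∪ᶠ BondsSame ends K₂ u v ∪ᶠ (BondsSep ends A u v ⊎ᶠ BondsSep ends B u v)) C →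
          Bonds ends H C
        from (inj₁ same) = onA.BondsSame-K⇒Bonds-H c₁ same
        from (inj₂ (inj₁ same)) = onB.BondsSame-K⇒Bonds-H c₂ same
        from (inj₂ (inj₂ (_ , _ , sep₁ , sep₂ , refl)))
          with BondsSep⇒oriented wf-A sep₁ | BondsSep⇒oriented wf-B sep₂
        ... | _ , bond₁ , refl , u∈S₁ , v∉S₁ | _ , bond₂ , refl , u∈S₂ , v∉S₂ =
          separating-bonds-glue bond₁ u∈S₁ v∉S₁ bond₂ u∈S₂ v∉S₂

  -- The four sums

  ⊕-gluing : ∀ (G₁ G₂ : Graph n m) u v → WellFormed ends G₁ → WellFormed ends G₂ →
    verts G₁ ∩ verts G₂ ≡ ⁅ u ⁆ ∪ ⁅ v ⁆ → Gluing
  ⊕-gluing G₁ G₂ u v wf₁ wf₂ meet = record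
    { A = G₁ ; B = G₂ ; H = G₁ ⊕ G₂ ; u = u ; v = v ; wf-A = wf₁ ; wf-B = wf₂
    ; verts-H⁺ = x∈p∪q⁺ ; verts-H⁻ = x∈p∪q⁻ (verts G₁) (verts G₂)
    ; edges-H⁺ = x∈p∪q⁺ ; edges-H⁻ = x∈p∪q⁻ (edges G₁) (edges G₂)
    ; shared = λ {x} x∈₁ x∈₂ → x∈⁅y⁆∪⁅z⁆⇒ (subst (x ∈_) meet (x∈p∩q⁺ (x∈₁ , x∈₂)))
    ; u∈A = proj₁ u∈₁₂ ; u∈B = proj₂ u∈₁₂ ; v∈A = proj₁ v∈₁₂ ; v∈B = proj₂ v∈₁₂ }
    where
    u∈₁₂ = x∈p∩q⁻ (verts G₁) (verts G₂) (subst (u ∈_) (sym meet) (x∈p∪q⁺ (inj₁ (x∈⁅x⁆ u))))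
    v∈₁₂ = x∈p∩q⁻ (verts G₁) (verts G₂) (subst (v ∈_) (sym meet) (x∈p∪q⁺ (inj₂ (x∈⁅x⁆ v))))

  ⊕⁻-gluing : ∀ (G₁ G₂ : Graph n m) e u v → WellFormed ends G₁ → WellFormed ends G₂ →
    verts G₁ ∩ verts G₂ ≡ ⁅ u ⁆ ∪ ⁅ v ⁆ → Gluing
  ⊕⁻-gluing G₁ G₂ e u v wf₁ wf₂ meet =
    record (⊕-gluing (G₁ ∖ₑ e) (G₂ ∖ₑ e) u v (wf-∖ₑ e wf₁) (wf-∖ₑ e wf₂) meet)
      { H = G₁ ⊕⁻[ e ] G₂ ; edges-H⁺ = edges⁺ ; edges-H⁻ = edges⁻ }
    where
    E₁ = edges G₁
    E₂ = edges G₂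
    edges⁺ : ∀ {f} → f ∈ E₁ - e ⊎ f ∈ E₂ - e → f ∈ (E₁ ∪ E₂) - e
    edges⁺ (inj₁ f∈) = let f∈E₁ , f∉e = x∈p─q⁻ E₁ ⁅ e ⁆ f∈ in x∈p─q⁺ (x∈p∪q⁺ (inj₁ f∈E₁)) f∉e
    edges⁺ (inj₂ f∈) = let f∈E₂ , f∉e = x∈p─q⁻ E₂ ⁅ e ⁆ f∈ in x∈p─q⁺ (x∈p∪q⁺ (inj₂ f∈E₂)) f∉e
    edges⁻ : ∀ {f} → f ∈ (E₁ ∪ E₂) - e → f ∈ E₁ - e ⊎ f ∈ E₂ - e
    edges⁻ f∈ = let f∈E , f∉e = x∈p─q⁻ (E₁ ∪ E₂) ⁅ e ⁆ f∈ in
      Sum.map (λ f∈E₁ → x∈p─q⁺ f∈E₁ f∉e) (λ f∈E₂ → x∈p─q⁺ f∈E₂ f∉e) (x∈p∪q⁻ E₁ E₂ f∈E)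

  shared-edge : ∀ {E₁ E₂ : Subset m} {e} → E₁ ∩ E₂ ≡ ⁅ e ⁆ → e ∈ E₁ × e ∈ E₂
  shared-edge {E₁} {E₂} {e} meet = x∈p∩q⁻ E₁ E₂ (subst (e ∈_) (sym meet) (x∈⁅x⁆ e))

  one-sum-bonds : ∀ {G₁ G₂ u} → WellFormed ends G₁ → WellFormed ends G₂ →
    Connected ends G₁ → Connected ends G₂ → verts G₁ ∩ verts G₂ ≡ ⁅ u ⁆ →
    Bonds ends (G₁ ⊕ G₂) ≈ᶠ (Bonds ends G₁ ∪ᶠ Bonds ends G₂)
  one-sum-bonds {G₁} {G₂} {u} wf₁ wf₂ connected₁ connected₂ meet =
    ≈ᶠ-trans (TwoSides.bonds-of-gluing Γ c₁ c₂) (λ _ → mk⇔ to from)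
    where
    Γ = ⊕-gluing G₁ G₂ u u wf₁ wf₂ (trans meet (sym (∪-idem ⁅ u ⁆)))
    open Gluing Γ using (u∈A; u∈B)
    c₁ = plain-completion Γ (λ _ → inj₁ refl) (Connected⇒Attached connected₂ u∈B)
    c₂ = plain-completion (swap Γ) (λ _ → inj₁ refl) (Connected⇒Attached connected₁ u∈A)
    to : ∀ {C} →
      (BondsSame ends G₁ u u ∪ᶠ BondsSame ends G₂ u u ∪ᶠ (BondsSep ends G₁ u u ⊎ᶠ BondsSep ends G₂ u u)) C →
      (Bonds ends G₁ ∪ᶠ Bonds ends G₂) C
    to (inj₁ same) = inj₁ (BondsSame⇒Bonds same)
    to (inj₂ (inj₁ same)) = inj₂ (BondsSame⇒Bonds same)
    to (inj₂ (inj₂ (_ , _ , sep , _))) = ⊥-elim (BondsSep-irrefl sep)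
    from : ∀ {C} → (Bonds ends G₁ ∪ᶠ Bonds ends G₂) C →
      (BondsSame ends G₁ u u ∪ᶠ BondsSame ends G₂ u u ∪ᶠ (BondsSep ends G₁ u u ⊎ᶠ BondsSep ends G₂ u u)) C
    from (inj₁ bond) = inj₁ (Bonds⇒BondsSame-refl u∈A bond)
    from (inj₂ bond) = inj₂ (inj₁ (Bonds⇒BondsSame-refl u∈B bond))

  edge-sum-bonds : ∀ {G₁ G₂ u v e} → WellFormed ends G₁ → WellFormed ends G₂ →
    Connected ends G₁ → Connected ends G₂ →
    ends e ≡ (u , v) → verts G₁ ∩ verts G₂ ≡ ⁅ u ⁆ ∪ ⁅ v ⁆ → edges G₁ ∩ edges G₂ ≡ ⁅ e ⁆ →
    Bonds ends (G₁ ⊕ G₂) ≈ᶠ (BondsĒ ends G₁ e ∪ᶠ BondsĒ ends G₂ e ∪ᶠ (BondsE ends G₁ e ⊎ᶠ BondsE ends G₂ e))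
  edge-sum-bonds {G₁} {G₂} {e = e} wf₁ wf₂ connected₁ connected₂ refl meet-V meet-E =
    TwoSides.bonds-of-gluing Γ c₁ c₂
    where
    Γ = ⊕-gluing G₁ G₂ _ _ wf₁ wf₂ meet-V
    open Gluing Γ
    c₁ = plain-completion Γ (λ _ → inj₂ (e , proj₁ (shared-edge meet-E) , inj₁ refl))
      (Connected⇒Attached connected₂ u∈B)
    c₂ = plain-completion (swap Γ) (λ _ → inj₂ (e , proj₂ (shared-edge meet-E) , inj₁ refl))
      (Connected⇒Attached connected₁ u∈A)

  deleted-edge-sum-bonds : ∀ {G₁ G₂ u v e} → WellFormed ends G₁ → WellFormed ends G₂ →
    ends e ≡ (u , v) → verts G₁ ∩ verts G₂ ≡ ⁅ u ⁆ ∪ ⁅ v ⁆ → edges G₁ ∩ edges G₂ ≡ ⁅ e ⁆ →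
    Connected ends (G₁ ∖ₑ e) → Connected ends (G₂ ∖ₑ e) →
    Bonds ends (G₁ ⊕⁻[ e ] G₂) ≈ᶠ
      (BondsĒ ends G₁ e ∪ᶠ BondsĒ ends G₂ e ∪ᶠ (BondsSep ends (G₁ ∖ₑ e) u v ⊎ᶠ BondsSep ends (G₂ ∖ₑ e) u v))
  deleted-edge-sum-bonds {G₁} {G₂} {e = e} wf₁ wf₂ refl meet-V meet-E connected₁ connected₂ =
    TwoSides.bonds-of-gluing Γ c₁ c₂
    where
    Γ = ⊕⁻-gluing G₁ G₂ e _ _ wf₁ wf₂ meet-V
    open Gluing Γ
    c₁ = edge-completion Γ (p─q⊆p _ _) x∈p∧x≢y⇒x∈p-y (proj₁ (shared-edge meet-E)) (inj₁ refl)
      (reach connected₂ u∈B v∈B) (Connected⇒Attached connected₂ u∈B)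
    c₂ = edge-completion (swap Γ) (p─q⊆p _ _) x∈p∧x≢y⇒x∈p-y (proj₂ (shared-edge meet-E)) (inj₁ refl)
      (reach connected₁ u∈A v∈A) (Connected⇒Attached connected₁ u∈A)

  deleted-edge-sum-bonds-bridge : ∀ {G₁ G₂ u v e} → WellFormed ends G₁ → WellFormed ends G₂ →
    Connected ends G₂ →
    ends e ≡ (u , v) → verts G₁ ∩ verts G₂ ≡ ⁅ u ⁆ ∪ ⁅ v ⁆ → edges G₁ ∩ edges G₂ ≡ ⁅ e ⁆ →
    Connected ends (G₁ ∖ₑ e) → ¬ Connected ends (G₂ ∖ₑ e) →
    Bonds ends (G₁ ⊕⁻[ e ] G₂) ≈ᶠ (Bonds ends (G₁ ∖ₑ e) ∪ᶠ BondsĒ ends G₂ e)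
  deleted-edge-sum-bonds-bridge {G₁} {G₂} {e = e} wf₁ wf₂ connected-G₂ refl meet-V meet-E
                                connected₁ disconnected₂ =
    ≈ᶠ-trans (TwoSides.bonds-of-gluing Γ c₁ c₂) (λ _ → mk⇔ to from)
    where
    Γ = ⊕⁻-gluing G₁ G₂ e _ _ wf₁ wf₂ meet-V
    open Gluing Γ
    attached-B : Attached B u v
    attached-B = ∖ₑ-attached connected-G₂ (inj₁ refl) u∈B
    u⇸v : ¬ Reach ends B (verts B) u v
    u⇸v = disconnected₂ ∘ Connected-attached u∈B attached-B
    c₁ = plain-completion Γ (⊥-elim ∘ u⇸v) attached-B
    c₂ = edge-completion (swap Γ) (p─q⊆p _ _) x∈p∧x≢y⇒x∈p-y (proj₂ (shared-edge meet-E)) (inj₁ refl)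
      (reach connected₁ u∈A v∈A) (Connected⇒Attached connected₁ u∈A)
    to : ∀ {C} →
      (BondsSame ends A u v ∪ᶠ BondsSame ends G₂ u v ∪ᶠ (BondsSep ends A u v ⊎ᶠ BondsSep ends B u v)) C →
      (Bonds ends A ∪ᶠ BondsSame ends G₂ u v) C
    to (inj₁ same) = inj₁ (BondsSame⇒Bonds same)
    to (inj₂ (inj₁ same)) = inj₂ same
    to (inj₂ (inj₂ (C₁ , _ , sep₁ , sep₂ , refl)))
      rewrite BondsSep⇒∅ wf-B v∈B u⇸v sep₂ | ∪-identityʳ C₁ = inj₁ (BondsSep⇒Bonds sep₁)
    from : ∀ {C} → (Bonds ends A ∪ᶠ BondsSame ends G₂ u v) C →
      (BondsSame ends A u v ∪ᶠ BondsSame ends G₂ u v ∪ᶠ (BondsSep ends A u v ⊎ᶠ BondsSep ends B u v)) C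
    from (inj₁ bond) with Bonds⇒BondsSame⊎BondsSep u∈A v∈A bond
    ... | inj₁ same = inj₁ same
    ... | inj₂ sep =
      inj₂ (inj₂ (_ , ∅ , sep , BondsSep-∅ wf-B u∈B v∈B attached-B u⇸v , sym (∪-identityʳ _)))
    from (inj₂ same) = inj₂ (inj₁ same)

lemma2 : ∀ {n m} (ends : Fin m → Fin n × Fin n) (G₁ G₂ : Graph n m) →
  WellFormed ends G₁ → WellFormed ends G₂ →
  Connected ends G₁ → Connected ends G₂ →
  (∀ u → verts G₁ ∩ verts G₂ ≡ ⁅ u ⁆ →
    Bonds ends (G₁ ⊕ G₂) ≈ᶠ (Bonds ends G₁ ∪ᶠ Bonds ends G₂))
  ×
  (∀ u v e → u ≢ v → ends e ≡ (u , v) →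
    verts G₁ ∩ verts G₂ ≡ ⁅ u ⁆ ∪ ⁅ v ⁆ → edges G₁ ∩ edges G₂ ≡ ⁅ e ⁆ →
    Bonds ends (G₁ ⊕ G₂) ≈ᶠ
      (BondsĒ ends G₁ e ∪ᶠ BondsĒ ends G₂ e ∪ᶠ (BondsE ends G₁ e ⊎ᶠ BondsE ends G₂ e)))
  ×
  (∀ u v e → u ≢ v → ends e ≡ (u , v) →
    verts G₁ ∩ verts G₂ ≡ ⁅ u ⁆ ∪ ⁅ v ⁆ → edges G₁ ∩ edges G₂ ≡ ⁅ e ⁆ →
    Connected ends (G₁ ∖ₑ e) → ¬ Connected ends (G₂ ∖ₑ e) →
    Bonds ends (G₁ ⊕⁻[ e ] G₂) ≈ᶠ (Bonds ends (G₁ ∖ₑ e) ∪ᶠ BondsĒ ends G₂ e))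
  ×
  (∀ u v e → u ≢ v → ends e ≡ (u , v) →
    verts G₁ ∩ verts G₂ ≡ ⁅ u ⁆ ∪ ⁅ v ⁆ → edges G₁ ∩ edges G₂ ≡ ⁅ e ⁆ →
    Connected ends (G₁ ∖ₑ e) → Connected ends (G₂ ∖ₑ e) →
    Bonds ends (G₁ ⊕⁻[ e ] G₂) ≈ᶠ
      (BondsĒ ends G₁ e ∪ᶠ BondsĒ ends G₂ e ∪ᶠ
        (BondsSep ends (G₁ ∖ₑ e) u v ⊎ᶠ BondsSep ends (G₂ ∖ₑ e) u v)))
lemma2 ends G₁ G₂ wf₁ wf₂ connected₁ connected₂ =
  (λ _ → one-sum-bonds ends wf₁ wf₂ connected₁ connected₂) ,
  (λ _ _ _ _ → edge-sum-bonds ends wf₁ wf₂ connected₁ connected₂) ,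
  (λ _ _ _ _ → deleted-edge-sum-bonds-bridge ends wf₁ wf₂ connected₂) ,
  (λ _ _ _ _ → deleted-edge-sum-bonds ends wf₁ wf₂)
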